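{- Let $H=(V,E)$ be a linear hypergraph, let $f\in E$ and $u,v,w\in V$ with $v\ne w$. If $P_1=u\dots vf$ and $P_2=u\dots wf$ are $\beta$-paths in $H$ (i.e., $\beta$-paths starting at the vertex $u$ whose last vertex is $v$, respectively $w$, and whose last edge is $f$), then there exists a $\beta$-cycle in $H$ of the form $fv\dots wf$ (i.e., a $\beta$-cycle $e_1v_1\dots e_mv_me_1$ with $e_1=f$, $v_1=v$ and $v_m=w$).
   Context: A hypergraph is linear if any two distinct edges share at most one vertex. A (finite) $\beta$-path is a sequence $v_1e_1v_2e_2\dots v_ne_n$ of alternating vertices and edges with $v_1,\dots,v_n$ distinct, $e_1,\dots,e_n$ distinct, and for $1\le i\le n$ the vertex $v_i$ belongs to $e_{i-1}$ and $e_i$ (with $e_0=e_1$) and to no other $e_j$. A $\beta$-cycle is a sequence $e_1v_1e_2v_2\dots e_nv_ne_1$, $n\ge3$, with $v_1,\dots,v_n$ distinct vertices, $e_1,\dots,e_n$ distinct edges, and for each $i$ the vertex $v_i$ belongs to $e_i$ and $e_{i+1}$ (where $e_{n+1}=e_1$) and to no other $e_j$. -}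

module Defs where

open import Data.Nat using (ℕ; zero; suc)
open import Data.Nat.DivMod using (_mod_)
open import Data.Fin using (Fin; toℕ; fromℕ; inject₁) renaming (zero to fzero; suc to fsuc)
open import Data.Fin.Subset using (Subset; _∈_; _∉_)
open import Data.Sum using (_⊎_)
open import Relation.Binary.PropositionalEquality using (_≡_; _≢_)
open import Function.Definitions using (Injective)

record Hypergraph : Set where
  field
    nV : ℕ
    nE : ℕ
    edge : Fin nE → Subset nV
    edge-distinct : Injective _≡_ _≡_ edge

open Hypergraph public

Vertex : Hypergraph → Set
Vertex H = Fin (nV H)

Edge : Hypergraph → Set
Edge H = Fin (nE H)

_∈ₑ_ : {H : Hypergraph} → Vertex H → Edge H → Set
_∈ₑ_ {H} x e = x ∈ edge H e

Linear : Hypergraph → Set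
Linear H = ∀ (e e' : Edge H) → e ≢ e' → ∀ (x y : Vertex H) →
  _∈ₑ_ {H} x e → _∈ₑ_ {H} x e' → _∈ₑ_ {H} y e → _∈ₑ_ {H} y e' → x ≡ y

-- β-path v_1 e_1 ... v_n e_n (n = len + 1 ≥ 1), 0-indexed:
-- vertex i lies in edge i and (for i > 0) in edge i-1, and in no other edge.
record βPath (H : Hypergraph) : Set where
  field
    len : ℕ
    vtx : Fin (suc len) → Vertex H
    edg : Fin (suc len) → Edge H
    vtx-inj : Injective _≡_ _≡_ vtx
    edg-inj : Injective _≡_ _≡_ edg
    in-cur  : ∀ i → _∈ₑ_ {H} (vtx i) (edg i)
    in-prev : ∀ (i : Fin len) → _∈ₑ_ {H} (vtx (fsuc i)) (edg (inject₁ i))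
    only    : ∀ i j → _∈ₑ_ {H} (vtx i) (edg j) →
              toℕ j ≡ toℕ i ⊎ suc (toℕ j) ≡ toℕ i

  first : Vertex H
  first = vtx fzero

  lastV : Vertex H
  lastV = vtx (fromℕ len)

  lastE : Edge H
  lastE = edg (fromℕ len)


next : ∀ {k} → Fin (suc k) → Fin (suc k)
next {k} i = suc (toℕ i) mod suc k

-- β-cycle e_1 v_1 e_2 v_2 ... e_m v_m e_1 with m = len + 3 ≥ 3, 0-indexed:
-- vertex i lies in edge i and edge (i+1 mod m), and in no other edge.
record βCycle (H : Hypergraph) : Set where
  field
    len : ℕ
    vtx : Fin (suc (suc (suc len))) → Vertex H
    edg : Fin (suc (suc (suc len))) → Edge H
    vtx-inj : Injective _≡_ _≡_ vtx
    edg-inj : Injective _≡_ _≡_ edg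
    in-cur  : ∀ i → _∈ₑ_ {H} (vtx i) (edg i)
    in-next : ∀ i → _∈ₑ_ {H} (vtx i) (edg (next i))
    only    : ∀ i j → _∈ₑ_ {H} (vtx i) (edg j) → j ≡ i ⊎ j ≡ next i

  firstE : Edge H
  firstE = edg fzero

  firstV : Vertex H
  firstV = vtx fzero

  lastV : Vertex H
  lastV = vtx (fromℕ (suc (suc len)))

{-# OPTIONS --safe #-}
-- Reversing P₁ and continuing along P₂ gives a closed walk f v … u … w f whose
-- other edges differ from f and which meets f only in v and w.  Whenever a
-- vertex of the walk lies in a non-consecutive edge (a chord), cutting out the
-- segment between them gives a shorter walk of the same kind, so a shortest one
-- is chordless, i.e. a β-cycle.  Linearity is needed only to exclude the walk
-- v e w of length one, where e and f would share both v and w.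
module Submission where

open import Defs
open import Data.Product using (Σ; _×_; _,_; proj₁; proj₂; ∃₂)
open import Relation.Binary.PropositionalEquality using (_≡_; _≢_; refl; sym; trans; cong; subst; subst₂; module ≡-Reasoning)
open import Data.Nat using (ℕ; zero; suc; _+_; _∸_; _≤_; _<_; z≤n; s≤s; z<s; s≤s⁻¹; _<?_; _≟_; _%_; NonZero)
open import Data.Nat.DivMod using (_mod_; m<n⇒m%n≡m; n%n≡0)
open import Data.Nat.Properties
open import Data.Nat.Induction using (<-wellFounded)
open import Algebra.Properties.CommutativeSemigroup +-commutativeSemigroup using (xy∙z≈xz∙y)
open import Data.Fin using (Fin; toℕ; fromℕ; fromℕ<; inject₁) renaming (zero to fzero; suc to fsuc)
open import Data.Fin.Properties using (toℕ-injective; toℕ<n; toℕ≤pred[n]; toℕ-fromℕ; toℕ-fromℕ<; toℕ-inject₁; any?)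
open import Data.Fin.Subset using (_∈_)
open import Data.Fin.Subset.Properties using (_∈?_)
open import Data.Sum using (_⊎_; inj₁; inj₂)
open import Function using (_∘_)
open import Induction.WellFounded using (Acc; acc)
open import Relation.Nullary using (yes; no; Dec; ¬?; _×-dec_; _⊎-dec_; contradiction)
open import Relation.Binary.Definitions using (tri<; tri≈; tri>)

switchAt : {A : Set} → ℕ → (ℕ → A) → (ℕ → A) → ℕ → A
switchAt p s t n with n <? p
... | yes _ = s n
... | no _ = t n

switchAt-< : ∀ {A : Set} {p n} {s t : ℕ → A} → n < p → switchAt p s t n ≡ s n
switchAt-< {p = p} {n} n<p with n <? p
... | yes _ = refl
... | no n≮p = contradiction n<p n≮p

switchAt-≥ : ∀ {A : Set} {p n} {s t : ℕ → A} → p ≤ n → switchAt p s t n ≡ t n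
switchAt-≥ {p = p} {n} p≤n with n <? p
... | yes n<p = contradiction n<p (≤⇒≯ p≤n)
... | no _ = refl

n≢0⇒n≢1⇒1<n : ∀ {n} → n ≢ 0 → n ≢ 1 → 1 < n
n≢0⇒n≢1⇒1<n {zero} n≢0 _ = contradiction refl n≢0
n≢0⇒n≢1⇒1<n {suc zero} _ n≢1 = contradiction refl n≢1
n≢0⇒n≢1⇒1<n {suc (suc _)} _ _ = s≤s (s≤s z≤n)

toℕ-mod : ∀ {m n} .{{_ : NonZero n}} → m < n → toℕ (m mod n) ≡ m
toℕ-mod m<n = trans (toℕ-fromℕ< _) (m<n⇒m%n≡m m<n)

mod-toℕ : ∀ {n} (i : Fin (suc n)) → toℕ i mod suc n ≡ i
mod-toℕ i = toℕ-injective (toℕ-mod (toℕ<n i))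

toℕ-next-< : ∀ {k} (i : Fin (suc k)) → toℕ i < k → toℕ (next i) ≡ suc (toℕ i)
toℕ-next-< i i<k = toℕ-mod (s≤s i<k)

toℕ-next-≡ : ∀ {k} (i : Fin (suc k)) → toℕ i ≡ k → toℕ (next i) ≡ 0
toℕ-next-≡ {k} i i≡k = trans (toℕ-fromℕ< _) (trans (cong (λ t → suc t % suc k) i≡k) (n%n≡0 (suc k)))

module _ (H : Hypergraph) where

  infix 4 _∈ᴱ_
  _∈ᴱ_ : Vertex H → Edge H → Set
  _∈ᴱ_ = _∈ₑ_ {H}

  -- ℕ-indexed access to a β-path; indices beyond len wrap around and are never used.
  module PathIndexing (P : βPath H) where
    open βPath P

    vtxᴺ : ℕ → Vertex H
    vtxᴺ m = vtx (m mod suc len)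

    edgᴺ : ℕ → Edge H
    edgᴺ m = edg (m mod suc len)

    mod-≡ : ∀ {m} (i : Fin (suc len)) → toℕ i ≡ m → m mod suc len ≡ i
    mod-≡ i refl = mod-toℕ i

    vtxᴺ-first : vtxᴺ 0 ≡ first
    vtxᴺ-first = cong vtx (mod-≡ fzero refl)

    vtxᴺ-last : vtxᴺ len ≡ lastV
    vtxᴺ-last = cong vtx (mod-≡ (fromℕ len) (toℕ-fromℕ len))

    edgᴺ-last : edgᴺ len ≡ lastE
    edgᴺ-last = cong edg (mod-≡ (fromℕ len) (toℕ-fromℕ len))

    ∈-curᴺ : ∀ m → vtxᴺ m ∈ᴱ edgᴺ m
    ∈-curᴺ m = in-cur _

    ∈-prevᴺ : ∀ {m} → m < len → vtxᴺ (suc m) ∈ᴱ edgᴺ m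
    ∈-prevᴺ m<len =
      subst₂ _∈ᴱ_ (cong vtx (sym (mod-≡ (fsuc i) (cong suc (toℕ-fromℕ< m<len)))))
                  (cong edg (sym (mod-≡ (inject₁ i) (trans (toℕ-inject₁ i) (toℕ-fromℕ< m<len)))))
                  (in-prev i)
      where i = fromℕ< m<len

    ∈lastE⇒lastV : ∀ a → vtx a ∈ᴱ lastE → vtx a ≡ lastV
    ∈lastE⇒lastV a a∈lastE with only a (fromℕ len) a∈lastE
    ... | inj₁ len≡a = cong vtx (toℕ-injective (sym len≡a))
    ... | inj₂ 1+len≡a = contradiction (trans (cong suc (sym (toℕ-fromℕ len))) 1+len≡a)
                                       (<⇒≢ (s≤s (toℕ≤pred[n] a)) ∘ sym)

    edgᴺ≢lastE : ∀ {m} → m < len → edgᴺ m ≢ lastE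
    edgᴺ≢lastE {m} m<len eq =
      <⇒≢ m<len (trans (sym (toℕ-mod (m<n⇒m<1+n m<len)))
                       (trans (cong toℕ (edg-inj eq)) (toℕ-fromℕ len)))

  module Walks (f : Edge H) (v w : Vertex H) where

    -- The candidate cycle f, vtx 0, edg 1, vtx 1, …, edg len, vtx len, f: a
    -- β-cycle except that vertices may also lie in non-consecutive edges.
    record Walk : Set where
      field
        len : ℕ
        vtx : ℕ → Vertex H
        edg : ℕ → Edge H
        vtx-first : vtx 0 ≡ v
        vtx-last  : vtx len ≡ w
        edg-first : edg 0 ≡ f
        ∈-next : ∀ n → n < len → vtx n ∈ᴱ edg (suc n)
        ∈-cur  : ∀ n → n < len → vtx (suc n) ∈ᴱ edg (suc n)
        edg≢f  : ∀ n → 1 ≤ n → n ≤ len → edg n ≢ f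
        ∈f⇒end : ∀ n → n ≤ len → vtx n ∈ᴱ f → vtx n ≡ v ⊎ vtx n ≡ w

    module _ (W : Walk) where
      open Walk W

      Chord : ℕ → ℕ → Set
      Chord i j = vtx i ∈ᴱ edg j × j ≢ 0 × j ≢ i × j ≢ suc i

      Chordless : Set
      Chordless = ∀ i j → i ≤ len → j ≤ len → j ≢ 0 → vtx i ∈ᴱ edg j → j ≡ i ⊎ j ≡ suc i

      chord? : ∀ i j → Dec (Chord i j)
      chord? i j = (vtx i ∈? edge H (edg j)) ×-dec ¬? (j ≟ 0) ×-dec ¬? (j ≟ i) ×-dec ¬? (j ≟ suc i)

      chordless⊎chord : Chordless ⊎ ∃₂ λ i j → i ≤ len × j ≤ len × Chord i j
      chordless⊎chord with any? {n = suc len} (λ i → any? {n = suc len} (λ j → chord? (toℕ i) (toℕ j)))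
      ... | yes (i , j , chord) = inj₂ (toℕ i , toℕ j , toℕ≤pred[n] i , toℕ≤pred[n] j , chord)
      ... | no ¬chord = inj₁ chordless
        where
        chordless : Chordless
        chordless i j i≤len j≤len j≢0 i∈j with (j ≟ i) ⊎-dec (j ≟ suc i)
        ... | yes consecutive = consecutive
        ... | no ¬consecutive = contradiction
          (fromℕ< (s≤s i≤len) , fromℕ< (s≤s j≤len) ,
           subst₂ Chord (sym (toℕ-fromℕ< _)) (sym (toℕ-fromℕ< _))
                  (i∈j , j≢0 , ¬consecutive ∘ inj₁ , ¬consecutive ∘ inj₂))
          ¬chord

    -- Cuts out the vertices suc m, …, m + d and d edges from position q on
    -- (q = suc m or suc (suc m)); the chord supplies one of the two incidences at the seam.
    module Shortcut (W : Walk) (m d r : ℕ) {q : ℕ} (m<q : m < q) (q≤2+m : q ≤ suc (suc m))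
                    (0<d : 0 < d) (len≡ : suc m + d + r ≡ Walk.len W) where
      open Walk W

      vtx′ : ℕ → Vertex H
      vtx′ = switchAt (suc m) vtx (λ n → vtx (n + d))

      edg′ : ℕ → Edge H
      edg′ = switchAt q edg (λ n → edg (n + d))

      vtx′-< : ∀ {n} → n < suc m → vtx′ n ≡ vtx n
      vtx′-< = switchAt-<

      vtx′-≥ : ∀ {n} → suc m ≤ n → vtx′ n ≡ vtx (n + d)
      vtx′-≥ = switchAt-≥

      edg′-< : ∀ {n} → n < q → edg′ n ≡ edg n
      edg′-< = switchAt-<

      edg′-≥ : ∀ {n} → q ≤ n → edg′ n ≡ edg (n + d)
      edg′-≥ = switchAt-≥

      len′ : ℕ
      len′ = suc m + r

      len′+d≡len : len′ + d ≡ len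
      len′+d≡len = trans (xy∙z≈xz∙y (suc m) r d) len≡

      shift-≤ : ∀ {n} → n ≤ len′ → n + d ≤ len
      shift-≤ {n} n≤len′ = subst (n + d ≤_) len′+d≡len (+-monoˡ-≤ d n≤len′)

      shorter : len′ < len
      shorter = subst (len′ <_) len′+d≡len (m<m+n len′ 0<d)

      walk : vtx′ m ∈ᴱ edg′ (suc m) → vtx′ (suc m) ∈ᴱ edg′ (suc m) → Walk
      walk seam-next seam-cur = record
        { len = len′ ; vtx = vtx′ ; edg = edg′
        ; vtx-first = trans (vtx′-< z<s) vtx-first
        ; vtx-last = trans (vtx′-≥ (m≤m+n (suc m) r)) (trans (cong vtx len′+d≡len) vtx-last)
        ; edg-first = trans (edg′-< (≤-<-trans z≤n m<q)) edg-first
        ; ∈-next = ∈-next′ ; ∈-cur = ∈-cur′ ; edg≢f = edg≢f′ ; ∈f⇒end = ∈f⇒end′ }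
        where
        len′≤len : len′ ≤ len
        len′≤len = <⇒≤ shorter

        ∈-next′ : ∀ n → n < len′ → vtx′ n ∈ᴱ edg′ (suc n)
        ∈-next′ n n<len′ with <-cmp n m
        ... | tri< n<m _ _ rewrite vtx′-< (m<n⇒m<1+n n<m) | edg′-< (≤-<-trans n<m m<q) =
              ∈-next n (<-≤-trans n<len′ len′≤len)
        ... | tri≈ _ refl _ = seam-next
        ... | tri> _ _ m<n rewrite vtx′-≥ m<n | edg′-≥ (≤-trans q≤2+m (s≤s m<n)) =
              ∈-next (n + d) (shift-≤ n<len′)

        ∈-cur′ : ∀ n → n < len′ → vtx′ (suc n) ∈ᴱ edg′ (suc n)
        ∈-cur′ n n<len′ with <-cmp n m
        ... | tri< n<m _ _ rewrite vtx′-< (s≤s n<m) | edg′-< (≤-<-trans n<m m<q) =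
              ∈-cur n (<-≤-trans n<len′ len′≤len)
        ... | tri≈ _ refl _ = seam-cur
        ... | tri> _ _ m<n rewrite vtx′-≥ (s≤s (<⇒≤ m<n)) | edg′-≥ (≤-trans q≤2+m (s≤s m<n)) =
              ∈-cur (n + d) (shift-≤ n<len′)

        edg≢f′ : ∀ n → 1 ≤ n → n ≤ len′ → edg′ n ≢ f
        edg≢f′ n 1≤n n≤len′ with <-≤-connex n q
        ... | inj₁ n<q rewrite edg′-< n<q = edg≢f n 1≤n (≤-trans n≤len′ len′≤len)
        ... | inj₂ q≤n rewrite edg′-≥ q≤n = edg≢f (n + d) (≤-trans 1≤n (m≤m+n n d)) (shift-≤ n≤len′)

        ∈f⇒end′ : ∀ n → n ≤ len′ → vtx′ n ∈ᴱ f → vtx′ n ≡ v ⊎ vtx′ n ≡ w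
        ∈f⇒end′ n n≤len′ with <-≤-connex n (suc m)
        ... | inj₁ n<1+m rewrite vtx′-< n<1+m = ∈f⇒end n (≤-trans n≤len′ len′≤len)
        ... | inj₂ 1+m≤n rewrite vtx′-≥ 1+m≤n = ∈f⇒end (n + d) (shift-≤ n≤len′)

    removeBackChord : (W : Walk) → ∀ {m i} → suc m ≤ i → suc m ≢ i → i ≤ Walk.len W →
                      Walk.vtx W i ∈ᴱ Walk.edg W (suc m) → Σ Walk λ W′ → Walk.len W′ < Walk.len W
    removeBackChord W {m} 1+m≤i 1+m≢i i≤len i∈1+m with m≤n⇒∃[o]m+o≡n 1+m≤i
    ... | zero , refl = contradiction (sym (+-identityʳ _)) 1+m≢i
    ... | suc d , refl = walk seam-next seam-cur , shorter
      where
      open Walk W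
      r = m≤n⇒∃[o]m+o≡n i≤len
      open Shortcut W m (suc d) (proj₁ r) (m<n⇒m<1+n (n<1+n m)) ≤-refl z<s (proj₂ r)

      seam-next : vtx′ m ∈ᴱ edg′ (suc m)
      seam-next rewrite vtx′-< (n<1+n m) | edg′-< (n<1+n (suc m)) = ∈-next m (≤-trans 1+m≤i i≤len)

      seam-cur : vtx′ (suc m) ∈ᴱ edg′ (suc m)
      seam-cur rewrite vtx′-≥ (≤-refl {suc m}) | edg′-< (n<1+n (suc m)) = i∈1+m

    removeForwardChord : (W : Walk) → ∀ {i m} → i ≤ m → suc m ≢ suc i → suc m ≤ Walk.len W →
                         Walk.vtx W i ∈ᴱ Walk.edg W (suc m) → Σ Walk λ W′ → Walk.len W′ < Walk.len W
    removeForwardChord W {i} i≤m 1+m≢1+i j≤len i∈j with m≤n⇒∃[o]m+o≡n i≤m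
    ... | zero , refl = contradiction (cong suc (+-identityʳ _)) 1+m≢1+i
    ... | suc d , refl = walk seam-next seam-cur , shorter
      where
      open Walk W
      r = m≤n⇒∃[o]m+o≡n j≤len
      open Shortcut W i (suc d) (proj₁ r) (n<1+n i) (n≤1+n (suc i)) z<s (proj₂ r)

      seam-next : vtx′ i ∈ᴱ edg′ (suc i)
      seam-next rewrite vtx′-< (n<1+n i) | edg′-≥ (≤-refl {suc i}) = i∈j

      seam-cur : vtx′ (suc i) ∈ᴱ edg′ (suc i)
      seam-cur rewrite vtx′-≥ (≤-refl {suc i}) | edg′-≥ (≤-refl {suc i}) =
        ∈-cur (i + suc d) (shift-≤ (m≤m+n (suc i) (proj₁ r)))

    removeChord : (W : Walk) → ∀ {i j} → i ≤ Walk.len W → j ≤ Walk.len W → Chord W i j →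
                  Σ Walk λ W′ → Walk.len W′ < Walk.len W
    removeChord W {j = zero} _ _ (_ , 0≢0 , _) = contradiction refl 0≢0
    removeChord W {i} {suc m} i≤len j≤len (i∈j , _ , j≢i , j≢1+i) with <-≤-connex i (suc m)
    ... | inj₁ i<j = removeForwardChord W (s≤s⁻¹ i<j) j≢1+i j≤len i∈j
    ... | inj₂ j≤i = removeBackChord W j≤i j≢i i≤len i∈j

    chordlessFrom : (W : Walk) → Acc _<_ (Walk.len W) → Σ Walk Chordless
    chordlessFrom W (acc smaller) with chordless⊎chord W
    ... | inj₁ chordless = W , chordless
    ... | inj₂ (_ , _ , i≤len , j≤len , chord) with removeChord W i≤len j≤len chord
    ...   | W′ , shorter = chordlessFrom W′ (smaller shorter)

    chordlessWalk : Walk → Σ Walk Chordless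
    chordlessWalk W = chordlessFrom W (<-wellFounded (Walk.len W))

    module ChordlessCycle (linear : Linear H) (v∈f : v ∈ᴱ f) (w∈f : w ∈ᴱ f) (v≢w : v ≢ w)
                          (W : Walk) (chordless : Chordless W) where
      open Walk W

      len≢0 : len ≢ 0
      len≢0 len≡0 = v≢w (trans (sym vtx-first) (trans (cong vtx (sym len≡0)) vtx-last))

      len≢1 : len ≢ 1
      len≢1 len≡1 = v≢w (linear (edg 1) f (edg≢f 1 ≤-refl 1≤len) v w v∈edg₁ v∈f w∈edg₁ w∈f)
        where
        1≤len : 1 ≤ len
        1≤len = ≤-reflexive (sym len≡1)
        v∈edg₁ : v ∈ᴱ edg 1
        v∈edg₁ = subst (_∈ᴱ edg 1) vtx-first (∈-next 0 1≤len)
        w∈edg₁ : w ∈ᴱ edg 1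
        w∈edg₁ = subst (_∈ᴱ edg 1) (trans (cong vtx (sym len≡1)) vtx-last) (∈-cur 0 1≤len)

      2≤len : 2 ≤ len
      2≤len = n≢0⇒n≢1⇒1<n len≢0 len≢1

      vtx≢vtx-suc : ∀ a → a < len → vtx a ≢ vtx (suc a)
      vtx≢vtx-suc zero _ eq
        with chordless 0 2 z≤n 2≤len (λ ()) (subst (_∈ᴱ edg 2) (sym eq) (∈-next 1 2≤len))
      ... | inj₁ ()
      ... | inj₂ ()
      vtx≢vtx-suc (suc a) 2+a≤len eq
        with chordless (suc (suc a)) (suc a) 2+a≤len (<⇒≤ 2+a≤len) (λ ())
                       (subst (_∈ᴱ edg (suc a)) eq (∈-cur a (<⇒≤ 2+a≤len)))
      ... | inj₁ ()
      ... | inj₂ ()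

      vtx-≢ : ∀ {a b} → a < b → b ≤ len → vtx a ≢ vtx b
      vtx-≢ {a} {b} a<b b≤len eq
        with chordless b (suc a) b≤len (≤-trans a<b b≤len) (λ ())
                       (subst (_∈ᴱ edg (suc a)) eq (∈-next a (<-≤-trans a<b b≤len)))
      ... | inj₁ refl = vtx≢vtx-suc a b≤len eq
      ... | inj₂ refl = <-irrefl refl a<b

      vtx-injective : ∀ {a b} → a ≤ len → b ≤ len → vtx a ≡ vtx b → a ≡ b
      vtx-injective {a} {b} a≤len b≤len eq with <-cmp a b
      ... | tri< a<b _ _ = contradiction eq (vtx-≢ a<b b≤len)
      ... | tri≈ _ a≡b _ = a≡b
      ... | tri> _ _ b<a = contradiction (sym eq) (vtx-≢ b<a a≤len)

      edg-≢ : ∀ {a b} → suc a < b → b ≤ len → edg (suc a) ≢ edg b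
      edg-≢ {a} {b} 1+a<b b≤len eq
        with chordless a b (<⇒≤ a<len) b≤len (m<n⇒n≢0 1+a<b)
                       (subst (vtx a ∈ᴱ_) eq (∈-next a a<len))
        where
        a<len : a < len
        a<len = <-≤-trans (<-trans (n<1+n a) 1+a<b) b≤len
      ... | inj₁ refl = <⇒≱ 1+a<b (n≤1+n a)
      ... | inj₂ refl = <-irrefl refl 1+a<b

      edg-injective : ∀ {a b} → a ≤ len → b ≤ len → edg a ≡ edg b → a ≡ b
      edg-injective {zero} {zero} _ _ _ = refl
      edg-injective {zero} {suc b} _ b≤len eq =
        contradiction (trans (sym eq) edg-first) (edg≢f (suc b) (s≤s z≤n) b≤len)
      edg-injective {suc a} {zero} a≤len _ eq =
        contradiction (trans eq edg-first) (edg≢f (suc a) (s≤s z≤n) a≤len)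
      edg-injective {suc a} {suc b} a≤len b≤len eq with <-cmp a b
      ... | tri< a<b _ _ = contradiction eq (edg-≢ (s≤s a<b) b≤len)
      ... | tri≈ _ a≡b _ = cong suc a≡b
      ... | tri> _ _ b<a = contradiction (sym eq) (edg-≢ (s≤s b<a) a≤len)

      vtx∈edg : ∀ a → a ≤ len → vtx a ∈ᴱ edg a
      vtx∈edg zero _ = subst₂ _∈ᴱ_ (sym vtx-first) (sym edg-first) v∈f
      vtx∈edg (suc a) a<len = ∈-cur a a<len

      L : ℕ
      L = len ∸ 2

      2+L≡len : 2 + L ≡ len
      2+L≡len = m+[n∸m]≡n 2≤len

      toℕ≤len : (i : Fin (3 + L)) → toℕ i ≤ len
      toℕ≤len i = subst (toℕ i ≤_) 2+L≡len (toℕ≤pred[n] i)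

      toℕ-next : (i : Fin (3 + L)) → toℕ i < len → toℕ (next i) ≡ suc (toℕ i)
      toℕ-next i i<len = toℕ-next-< i (subst (toℕ i <_) (sym 2+L≡len) i<len)

      toℕ-next-len : (i : Fin (3 + L)) → toℕ i ≡ len → toℕ (next i) ≡ 0
      toℕ-next-len i i≡len = toℕ-next-≡ i (trans i≡len (sym 2+L≡len))

      in-next : (i : Fin (3 + L)) → vtx (toℕ i) ∈ᴱ edg (toℕ (next i))
      in-next i with m≤n⇒m<n∨m≡n (toℕ≤len i)
      ... | inj₁ i<len rewrite toℕ-next i i<len = ∈-next (toℕ i) i<len
      ... | inj₂ i≡len rewrite toℕ-next-len i i≡len | i≡len =
            subst₂ _∈ᴱ_ (sym vtx-last) (sym edg-first) w∈f

      only : (i j : Fin (3 + L)) → vtx (toℕ i) ∈ᴱ edg (toℕ j) → j ≡ i ⊎ j ≡ next i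
      only i fzero i∈j with ∈f⇒end (toℕ i) (toℕ≤len i) (subst (vtx (toℕ i) ∈ᴱ_) edg-first i∈j)
      ... | inj₁ ≡v = inj₁ (toℕ-injective (sym (vtx-injective (toℕ≤len i) z≤n (trans ≡v (sym vtx-first)))))
      ... | inj₂ ≡w = inj₂ (toℕ-injective (sym (toℕ-next-len i
                              (vtx-injective (toℕ≤len i) ≤-refl (trans ≡w (sym vtx-last))))))
      only i (fsuc j) i∈j with chordless (toℕ i) (suc (toℕ j)) (toℕ≤len i) (toℕ≤len (fsuc j)) (λ ()) i∈j
      ... | inj₁ j≡i = inj₁ (toℕ-injective j≡i)
      ... | inj₂ j≡1+i = inj₂ (toℕ-injective
              (trans j≡1+i (sym (toℕ-next i (subst (_≤ len) j≡1+i (toℕ≤len (fsuc j)))))))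

      cycle : βCycle H
      cycle = record
        { len = L ; vtx = vtx ∘ toℕ ; edg = edg ∘ toℕ
        ; vtx-inj = λ {i} {j} eq → toℕ-injective (vtx-injective (toℕ≤len i) (toℕ≤len j) eq)
        ; edg-inj = λ {i} {j} eq → toℕ-injective (edg-injective (toℕ≤len i) (toℕ≤len j) eq)
        ; in-cur = λ i → vtx∈edg (toℕ i) (toℕ≤len i)
        ; in-next = in-next
        ; only = only }

      cycle-ends : βCycle.firstE cycle ≡ f × βCycle.firstV cycle ≡ v × βCycle.lastV cycle ≡ w
      cycle-ends = edg-first , vtx-first ,
                   trans (cong vtx (trans (toℕ-fromℕ (2 + L)) 2+L≡len)) vtx-last

  module Concatenation (P₁ P₂ : βPath H) (same-first : βPath.first P₁ ≡ βPath.first P₂)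
                       (same-lastE : βPath.lastE P₁ ≡ βPath.lastE P₂) where
    open PathIndexing
    open Walks (βPath.lastE P₁) (βPath.lastV P₁) (βPath.lastV P₂)

    n₁ n₂ : ℕ
    n₁ = βPath.len P₁
    n₂ = βPath.len P₂

    vtx : ℕ → Vertex H
    vtx = switchAt n₁ (λ n → vtxᴺ P₁ (n₁ ∸ n)) (λ n → vtxᴺ P₂ (n ∸ n₁))

    edg : ℕ → Edge H
    edg = switchAt (suc n₁) (λ n → edgᴺ P₁ (n₁ ∸ n)) (λ n → edgᴺ P₂ (n ∸ suc n₁))

    vtx-< : ∀ {n} → n < n₁ → vtx n ≡ vtxᴺ P₁ (n₁ ∸ n)
    vtx-< = switchAt-<

    vtx-≥ : ∀ {n} → n₁ ≤ n → vtx n ≡ vtxᴺ P₂ (n ∸ n₁)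
    vtx-≥ = switchAt-≥

    edg-< : ∀ {n} → n < suc n₁ → edg n ≡ edgᴺ P₁ (n₁ ∸ n)
    edg-< = switchAt-<

    edg-≥ : ∀ {n} → suc n₁ ≤ n → edg n ≡ edgᴺ P₂ (n ∸ suc n₁)
    edg-≥ = switchAt-≥

    shared-first : vtxᴺ P₁ 0 ≡ vtxᴺ P₂ 0
    shared-first = trans (vtxᴺ-first P₁) (trans same-first (sym (vtxᴺ-first P₂)))

    vtx-first : vtx 0 ≡ βPath.lastV P₁
    vtx-first with <-≤-connex 0 n₁
    ... | inj₁ 0<n₁ = trans (vtx-< 0<n₁) (vtxᴺ-last P₁)
    ... | inj₂ n₁≤0 = begin
      vtx 0                ≡⟨ vtx-≥ n₁≤0 ⟩
      vtxᴺ P₂ (0 ∸ n₁)     ≡⟨ cong (vtxᴺ P₂) (0∸n≡0 n₁) ⟩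
      vtxᴺ P₂ 0            ≡⟨ sym shared-first ⟩
      vtxᴺ P₁ 0            ≡⟨ cong (vtxᴺ P₁) (sym (n≤0⇒n≡0 n₁≤0)) ⟩
      vtxᴺ P₁ n₁           ≡⟨ vtxᴺ-last P₁ ⟩
      βPath.lastV P₁       ∎
      where open ≡-Reasoning

    ∈-next : ∀ n → n < n₁ + n₂ → vtx n ∈ᴱ edg (suc n)
    ∈-next n _ with <-≤-connex n n₁
    ... | inj₁ n<n₁ rewrite vtx-< n<n₁ | edg-< (s≤s n<n₁) =
          subst (_∈ᴱ edgᴺ P₁ (n₁ ∸ suc n)) (cong (vtxᴺ P₁) (sym (+-∸-assoc 1 n<n₁)))
                (∈-prevᴺ P₁ (∸-monoʳ-< z<s n<n₁))
    ... | inj₂ n₁≤n rewrite vtx-≥ n₁≤n | edg-≥ (s≤s n₁≤n) = ∈-curᴺ P₂ (n ∸ n₁)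

    ∈-cur : ∀ n → n < n₁ + n₂ → vtx (suc n) ∈ᴱ edg (suc n)
    ∈-cur n n<len with <-cmp (suc n) n₁
    ... | tri< 1+n<n₁ _ _ rewrite vtx-< 1+n<n₁ | edg-< (m<n⇒m<1+n 1+n<n₁) = ∈-curᴺ P₁ (n₁ ∸ suc n)
    ... | tri≈ _ 1+n≡n₁ _ rewrite vtx-≥ (≤-reflexive (sym 1+n≡n₁)) | edg-< (s≤s (≤-reflexive 1+n≡n₁)) =
          subst₂ _∈ᴱ_ (cong (vtxᴺ P₂) (sym (m≤n⇒m∸n≡0 (≤-reflexive 1+n≡n₁))))
                      (cong (edgᴺ P₁) (sym (m≤n⇒m∸n≡0 (≤-reflexive (sym 1+n≡n₁)))))
                      (subst (_∈ᴱ edgᴺ P₁ 0) shared-first (∈-curᴺ P₁ 0))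
    ... | tri> _ _ n₁<1+n rewrite vtx-≥ (<⇒≤ n₁<1+n) | edg-≥ n₁<1+n =
          subst (_∈ᴱ edgᴺ P₂ (n ∸ n₁)) (cong (vtxᴺ P₂) (sym (+-∸-assoc 1 n₁≤n)))
                (∈-prevᴺ P₂ (subst (n ∸ n₁ <_) (m+n∸m≡n n₁ n₂) (∸-monoˡ-< n<len n₁≤n)))
      where
      n₁≤n : n₁ ≤ n
      n₁≤n = s≤s⁻¹ n₁<1+n

    edg≢f : ∀ n → 1 ≤ n → n ≤ n₁ + n₂ → edg n ≢ βPath.lastE P₁
    edg≢f n 1≤n n≤len with <-≤-connex n (suc n₁)
    ... | inj₁ n<1+n₁ rewrite edg-< n<1+n₁ = edgᴺ≢lastE P₁ (∸-monoʳ-< 1≤n (s≤s⁻¹ n<1+n₁))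
    ... | inj₂ 1+n₁≤n rewrite edg-≥ 1+n₁≤n = λ eq →
          edgᴺ≢lastE P₂ (subst (n ∸ suc n₁ <_) (m+n∸m≡n (suc n₁) n₂) (∸-monoˡ-< (s≤s n≤len) 1+n₁≤n))
                         (trans eq same-lastE)

    ∈f⇒end : ∀ n → n ≤ n₁ + n₂ → vtx n ∈ᴱ βPath.lastE P₁ →
             vtx n ≡ βPath.lastV P₁ ⊎ vtx n ≡ βPath.lastV P₂
    ∈f⇒end n _ with <-≤-connex n n₁
    ... | inj₁ n<n₁ rewrite vtx-< n<n₁ = λ n∈f → inj₁ (∈lastE⇒lastV P₁ _ n∈f)
    ... | inj₂ n₁≤n rewrite vtx-≥ n₁≤n = λ n∈f → inj₂ (∈lastE⇒lastV P₂ _ (subst (_ ∈ᴱ_) same-lastE n∈f))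

    walk : Walk
    walk = record
      { len = n₁ + n₂ ; vtx = vtx ; edg = edg
      ; vtx-first = vtx-first
      ; vtx-last = trans (vtx-≥ (m≤m+n n₁ n₂)) (trans (cong (vtxᴺ P₂) (m+n∸m≡n n₁ n₂)) (vtxᴺ-last P₂))
      ; edg-first = trans (edg-< z<s) (edgᴺ-last P₁)
      ; ∈-next = ∈-next ; ∈-cur = ∈-cur ; edg≢f = edg≢f ; ∈f⇒end = ∈f⇒end }

lemma3p3 : (H : Hypergraph) → Linear H →
    (f : Edge H) (u v w : Vertex H) → v ≢ w →
    (P₁ P₂ : βPath H) →
    βPath.first P₁ ≡ u → βPath.lastV P₁ ≡ v → βPath.lastE P₁ ≡ f →
    βPath.first P₂ ≡ u → βPath.lastV P₂ ≡ w → βPath.lastE P₂ ≡ f →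
    Σ (βCycle H) (λ C → βCycle.firstE C ≡ f × βCycle.firstV C ≡ v × βCycle.lastV C ≡ w)
lemma3p3 H linear f u v w v≢w P₁ P₂ refl refl refl first₂≡u refl lastE₂≡f
  with Walks.chordlessWalk H f v w (Concatenation.walk H P₁ P₂ (sym first₂≡u) (sym lastE₂≡f))
... | W , chordless = cycle , cycle-ends
  where
  v∈f : v ∈ edge H f
  v∈f = βPath.in-cur P₁ (fromℕ (βPath.len P₁))
  w∈f : w ∈ edge H f
  w∈f = subst (λ e → w ∈ edge H e) lastE₂≡f (βPath.in-cur P₂ (fromℕ (βPath.len P₂)))
  open Walks.ChordlessCycle H f v w linear v∈f w∈f v≢w W chordless
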